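{- Let $M$ be a matroid on a finite linearly ordered ground set $(E,<)$. Any linear extension of Las Vergnas's external/internal order $<_{ext/int}$ on the set of bases of $M$ is a shelling order of the independence complex $IN(M)$.
   Context: For a basis $B$ and $e\in E-B$, $\mathrm{Circ}(B,e)$ is the unique circuit in $B\cup e$; for $i\in B$, $\mathrm{Cocirc}(B,i)=\{x\in E: B\cup x-i \text{ is a basis}\}$. $EA(B)=\{e\in E-B: e=\min\mathrm{Circ}(B,e)\}$, $EP(B)=(E-B)-EA(B)$, $IA(B)=\{i\in B: i=\min\mathrm{Cocirc}(B,i)\}$, $IP(B)=B-IA(B)$. The external/internal order: $A\le_{ext/int}B$ iff $IP(A)\cap EP(B)=\emptyset$. $IN(M)$ is the complex of independent sets of $M$. A shelling order of a pure complex is an ordering $F_1,\dots,F_k$ of its facets such that for all $i<j$ there exist $l<j$ and $f\in F_j$ with $F_i\cap F_j\subseteq F_l\cap F_j=F_j-\{f\}$. -}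

module Defs where

open import Data.Nat using (ℕ; _≤_; _<_)
open import Data.Fin using (Fin; toℕ)
open import Data.Fin.Subset using (Subset; _∈_; _∉_; _⊆_; _⊂_; _∩_; _∪_; _-_; ⁅_⁆)
open import Data.List using (List; length; lookup)
open import Data.List.Relation.Unary.Unique.Propositional using (Unique)
import Data.List.Membership.Propositional as LM
open import Data.Product using (Σ; ∃; ∃-syntax; _×_)
open import Relation.Binary.PropositionalEquality using (_≡_)
open import Relation.Nullary using (¬_; Dec)
open import Function.Bundles using (_⇔_)

-- A matroid on the linearly ordered ground set Fin n (natural order),
-- given by its set of bases, with the basis axioms.
record Matroid (n : ℕ) : Set₁ where
  field
    IsBasis   : Subset n → Set
    isBasis?  : (B : Subset n) → Dec (IsBasis B)
    nonempty  : ∃[ B ] IsBasis B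
    exchange  : ∀ {B₁ B₂} → IsBasis B₁ → IsBasis B₂ →
                ∀ {x} → x ∈ B₁ → x ∉ B₂ →
                ∃[ y ] (y ∈ B₂ × y ∉ B₁ × IsBasis ((B₁ - x) ∪ ⁅ y ⁆))

module _ {n : ℕ} (M : Matroid n) where
  open Matroid M

  Independent : Subset n → Set
  Independent I = ∃[ B ] (IsBasis B × I ⊆ B)

  IsCircuit : Subset n → Set
  IsCircuit C = ¬ Independent C × (∀ D → D ⊂ C → Independent D)

  -- x ∈ Circ(B,e), where Circ(B,e) is the (unique) circuit contained in B ∪ e
  InCirc : Subset n → Fin n → Fin n → Set
  InCirc B e x = ∃[ C ] (IsCircuit C × C ⊆ (B ∪ ⁅ e ⁆) × x ∈ C)

  InCocirc : Subset n → Fin n → Fin n → Set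
  InCocirc B i x = IsBasis ((B ∪ ⁅ x ⁆) - i)

  EA : Subset n → Fin n → Set
  EA B e = e ∉ B × (∀ x → InCirc B e x → toℕ e ≤ toℕ x)

  EP : Subset n → Fin n → Set
  EP B e = e ∉ B × ¬ EA B e

  IA : Subset n → Fin n → Set
  IA B i = i ∈ B × (∀ x → InCocirc B i x → toℕ i ≤ toℕ x)

  IP : Subset n → Fin n → Set
  IP B i = i ∈ B × ¬ IA B i

  _≤ext/int_ : Subset n → Subset n → Set
  A ≤ext/int B = ∀ x → ¬ (IP A x × EP B x)

  EnumeratesBases : List (Subset n) → Set
  EnumeratesBases L = Unique L × (∀ B → (B LM.∈ L) ⇔ IsBasis B)

  LinearExtension : List (Subset n) → Set
  LinearExtension L = EnumeratesBases L ×
    (∀ (i j : Fin (length L)) → lookup L i ≤ext/int lookup L j → toℕ i ≤ toℕ j)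

ShellingOrder : {n : ℕ} → (Facet : Subset n → Set) → List (Subset n) → Set
ShellingOrder {n} Facet L =
  (Unique L × (∀ F → (F LM.∈ L) ⇔ Facet F)) ×
  (∀ (i j : Fin (length L)) → toℕ i < toℕ j →
     ∃[ l ] ∃[ f ] (toℕ l < toℕ j × f ∈ lookup L j ×
       ((lookup L i ∩ lookup L j) ⊆ (lookup L l ∩ lookup L j)) ×
       ((lookup L l ∩ lookup L j) ≡ (lookup L j - f))))

INFacet : {n : ℕ} → Matroid n → Subset n → Set
INFacet M F = Independent M F × (∀ G → Independent M G → F ⊆ G → G ≡ F)

-- If Bᵢ precedes Bⱼ then Bⱼ ≰ Bᵢ, so some internally passive x of Bⱼ lies outside Bᵢ.
-- Exchanging x for the least element y of its cocircuit (y < x as x is passive) gives a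
-- basis B′ = Bⱼ - x + y in which y is internally active; all other elements of B′ lie in
-- Bⱼ, hence IP(B′) ∩ EP(Bⱼ) = ∅, i.e. B′ ≤ext/int Bⱼ, and B′ comes earlier in the order.
-- Since x ∉ Bᵢ, the intersection B′ ∩ Bⱼ = Bⱼ - x contains Bᵢ ∩ Bⱼ.
module Submission where

open import Defs
open import Data.Nat using (ℕ; _≤_; _<_; _≤?_)
open import Data.Nat.Properties
  using (≤-refl; ≤-trans; <⇒≤; <-irrefl; <⇒≱; ≮⇒≥; ≰⇒>; ≤∧≢⇒<)
open import Data.Fin using (Fin; toℕ; fromℕ<; _≟_)
open import Data.Fin.Properties
  using (¬∀⟶∃¬; ¬∀⟶∃¬-smallest; toℕ-inject; toℕ-fromℕ<; toℕ-injective; any?; all?)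
open import Data.Fin.Subset using (Subset; _∈_; _∉_; _⊆_; _∩_; _∪_; _─_; _-_; ⁅_⁆; inside; outside)
open import Data.Fin.Subset.Properties
  using (_∈?_; x∈⁅x⁆; x∈⁅y⁆⇒x≡y; p⊆p∪q; q⊆p∪q; x∈p∪q⁻; p─q⊆p; x∈p∧x≢y⇒x∈p-y;
         x∈p∩q⁺; x∈p∩q⁻; ⊆-refl; ⊆-trans; ⊆-antisym)
open import Data.Vec using (_∷_)
open import Data.Vec.Base using (here; there)
open import Data.List using (List; length; lookup)
open import Data.List.Relation.Unary.Any using (index)
open import Data.List.Relation.Unary.Any.Properties using (lookup-index)
open import Data.List.Membership.Propositional using () renaming (_∈_ to _∈ᴸ_)
open import Data.List.Membership.Propositional.Properties using (∈-lookup)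
open import Data.Product using (∃; ∃-syntax; _×_; _,_)
open import Data.Sum using (_⊎_; inj₁; inj₂)
open import Data.Empty using (⊥-elim)
open import Function using (_∘_)
open import Function.Bundles using (_⇔_; mk⇔; Equivalence)
import Function.Properties.Equivalence as ⇔
open import Relation.Binary.PropositionalEquality using (_≡_; _≢_; refl; sym; trans; subst; cong)
open import Relation.Nullary using (¬_; Dec; yes; no; contradiction)
open import Relation.Nullary.Decidable using (_×-dec_; _→-dec_; ¬?; decidable-stable)
open import Relation.Unary using (Pred; Decidable)

x∈p─q⇒x∉q : ∀ {n} (p q : Subset n) {x} → x ∈ p ─ q → x ∉ q
x∈p─q⇒x∉q (inside ∷ p) (outside ∷ q) here ()
x∈p─q⇒x∉q (_ ∷ p) (_ ∷ q) (there x∈p─q) (there x∈q) = x∈p─q⇒x∉q p q x∈p─q x∈q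

module _ {n : ℕ} where

  x∈p-y⇒x∈p : ∀ {p : Subset n} {x y} → x ∈ p - y → x ∈ p
  x∈p-y⇒x∈p {p} {y = y} = p─q⊆p p ⁅ y ⁆

  x∈p-y⇒x≢y : ∀ {p : Subset n} {x y} → x ∈ p - y → x ≢ y
  x∈p-y⇒x≢y {p} {y = y} x∈p-y refl = x∈p─q⇒x∉q p ⁅ y ⁆ x∈p-y (x∈⁅x⁆ y)

  x∈p⇒x∈p∪⁅y⁆ : ∀ {p : Subset n} {x y} → x ∈ p → x ∈ p ∪ ⁅ y ⁆
  x∈p⇒x∈p∪⁅y⁆ {y = y} = p⊆p∪q ⁅ y ⁆

  y∈p∪⁅y⁆ : ∀ (p : Subset n) y → y ∈ p ∪ ⁅ y ⁆
  y∈p∪⁅y⁆ p y = q⊆p∪q p ⁅ y ⁆ (x∈⁅x⁆ y)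

  x∈p∪⁅y⁆⇒x∈p⊎x≡y : ∀ {p : Subset n} {x y} → x ∈ p ∪ ⁅ y ⁆ → x ∈ p ⊎ x ≡ y
  x∈p∪⁅y⁆⇒x∈p⊎x≡y {p} {y = y} x∈p∪⁅y⁆ with x∈p∪q⁻ p ⁅ y ⁆ x∈p∪⁅y⁆
  ... | inj₁ x∈p = inj₁ x∈p
  ... | inj₂ x∈⁅y⁆ = inj₂ (x∈⁅y⁆⇒x≡y y x∈⁅y⁆)

  -- B - x + y, written exactly as in InCocirc
  _[_↦_] : Subset n → Fin n → Fin n → Subset n
  B [ x ↦ y ] = (B ∪ ⁅ y ⁆) - x

  ∈[↦]⁻ : ∀ {B : Subset n} {x y z} → z ∈ B [ x ↦ y ] → (z ∈ B ⊎ z ≡ y) × z ≢ x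
  ∈[↦]⁻ z∈ = x∈p∪⁅y⁆⇒x∈p⊎x≡y (x∈p-y⇒x∈p z∈) , x∈p-y⇒x≢y z∈

  x∉B[x↦y] : ∀ {B : Subset n} x y → x ∉ B [ x ↦ y ]
  x∉B[x↦y] x y x∈ = x∈p-y⇒x≢y x∈ refl

  ∈[↦]⁺ˡ : ∀ {B : Subset n} {x y z} → z ∈ B → z ≢ x → z ∈ B [ x ↦ y ]
  ∈[↦]⁺ˡ z∈B = x∈p∧x≢y⇒x∈p-y (x∈p⇒x∈p∪⁅y⁆ z∈B)

  ∈[↦]⁺ʳ : ∀ {B : Subset n} {x y} → y ≢ x → y ∈ B [ x ↦ y ]
  ∈[↦]⁺ʳ {B} {y = y} = x∈p∧x≢y⇒x∈p-y (y∈p∪⁅y⁆ B y)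

  [↦][↦] : ∀ {B : Subset n} {x y w} → y ∉ B → w ≢ x → w ≢ y →
           (B [ x ↦ y ]) [ y ↦ w ] ≡ B [ x ↦ w ]
  [↦][↦] {B} {x} {y} {w} y∉B w≢x w≢y = ⊆-antisym forward backward
    where
    forward : (B [ x ↦ y ]) [ y ↦ w ] ⊆ B [ x ↦ w ]
    forward z∈ with ∈[↦]⁻ z∈
    ... | inj₂ refl , _ = ∈[↦]⁺ʳ w≢x
    ... | inj₁ z∈B[x↦y] , z≢y with ∈[↦]⁻ z∈B[x↦y]
    ...   | inj₁ z∈B , z≢x = ∈[↦]⁺ˡ z∈B z≢x
    ...   | inj₂ z≡y , _ = contradiction z≡y z≢y
    backward : B [ x ↦ w ] ⊆ (B [ x ↦ y ]) [ y ↦ w ]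
    backward z∈ with ∈[↦]⁻ z∈
    ... | inj₂ refl , _ = ∈[↦]⁺ʳ w≢y
    ... | inj₁ z∈B , z≢x = ∈[↦]⁺ˡ (∈[↦]⁺ˡ z∈B z≢x) (λ { refl → y∉B z∈B })

  ∩-⊆-[↦]∩ : ∀ {A B : Subset n} {x} y → x ∉ A → A ∩ B ⊆ B [ x ↦ y ] ∩ B
  ∩-⊆-[↦]∩ {A} {B} y x∉A z∈A∩B with x∈p∩q⁻ A B z∈A∩B
  ... | z∈A , z∈B = x∈p∩q⁺ (∈[↦]⁺ˡ z∈B (λ { refl → x∉A z∈A }) , z∈B)

  [↦]∩≡- : ∀ {B : Subset n} {x y} → y ∉ B → B [ x ↦ y ] ∩ B ≡ B - x
  [↦]∩≡- {B} {x} {y} y∉B = ⊆-antisym forward backward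
    where
    forward : B [ x ↦ y ] ∩ B ⊆ B - x
    forward z∈ with x∈p∩q⁻ (B [ x ↦ y ]) B z∈
    ... | z∈B[x↦y] , z∈B = x∈p∧x≢y⇒x∈p-y z∈B (x∈p-y⇒x≢y z∈B[x↦y])
    backward : B - x ⊆ B [ x ↦ y ] ∩ B
    backward z∈B-x = x∈p∩q⁺ (∈[↦]⁺ˡ (x∈p-y⇒x∈p z∈B-x) (x∈p-y⇒x≢y z∈B-x) , x∈p-y⇒x∈p z∈B-x)

∃-least : ∀ {n p} (P : Pred (Fin n) p) → Decidable P → ∃ P →
        ∃[ y ] (P y × ∀ w → P w → toℕ y ≤ toℕ w)
∃-least P P? (i , Pi) with ¬∀⟶∃¬-smallest _ (¬_ ∘ P) (¬? ∘ P?) (λ ∀¬P → ∀¬P i Pi)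
... | y , ¬¬Py , ¬P-below = y , decidable-stable (P? y) ¬¬Py , y≤
  where
  y≤ : ∀ w → P w → toℕ y ≤ toℕ w
  y≤ w Pw = ≮⇒≥ λ w<y → ¬P-below (fromℕ< w<y)
    (subst P (sym (toℕ-injective (trans (toℕ-inject (fromℕ< w<y)) (toℕ-fromℕ< w<y)))) Pw)

module _ {n : ℕ} (M : Matroid n) where
  open Matroid M

  basis-⊆⇒≡ : ∀ {A B} → IsBasis A → IsBasis B → A ⊆ B → A ≡ B
  basis-⊆⇒≡ {A} {B} bA bB A⊆B = ⊆-antisym A⊆B B⊆A
    where
    B⊆A : B ⊆ A
    B⊆A {x} x∈B with x ∈? A
    ... | yes x∈A = x∈A
    ... | no x∉A with exchange bB bA x∈B x∉A
    ...   | y , y∈A , y∉B , _ = contradiction (A⊆B y∈A) y∉B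

  isBasis⇔INFacet : ∀ F → IsBasis F ⇔ INFacet M F
  isBasis⇔INFacet F = mk⇔ to from
    where
    to : IsBasis F → INFacet M F
    to bF = (F , bF , ⊆-refl) , λ { G (B , bB , G⊆B) F⊆G →
      ⊆-antisym (subst (G ⊆_) (sym (basis-⊆⇒≡ bF bB (⊆-trans F⊆G G⊆B))) G⊆B) F⊆G }
    from : INFacet M F → IsBasis F
    from ((B , bB , F⊆B) , maximal) = subst IsBasis (maximal B (B , bB , ⊆-refl) F⊆B) bB

  IA? : ∀ B x → Dec (IA M B x)
  IA? B x = (x ∈? B) ×-dec all? (λ y → isBasis? (B [ x ↦ y ]) →-dec (toℕ x ≤? toℕ y))

  ≰ext/int⇒IP-outside : ∀ {A B} → ¬ (_≤ext/int_ M A B) → ∃[ x ] (IP M A x × x ∉ B)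
  ≰ext/int⇒IP-outside {A} {B} A≰B
    with any? (λ x → ((x ∈? A) ×-dec ¬? (IA? A x)) ×-dec ¬? (x ∈? B))
  ... | yes found = found
  ... | no none = contradiction (λ x (IPx , x∉B , _) → none (x , IPx , x∉B)) A≰B

  IA-outside⇒≤ext/int : ∀ {A B} → (∀ z → z ∈ A → z ∉ B → IA M A z) → _≤ext/int_ M A B
  IA-outside⇒≤ext/int IA-outside z ((z∈A , ¬IA) , z∉B , _) = ¬IA (IA-outside z z∈A z∉B)

  IP⇒Cocirc-nonempty : ∀ {B x} → IP M B x → ∃ (InCocirc M B x)
  IP⇒Cocirc-nonempty {B} {x} (x∈B , ¬IA)
    with w , ¬[Cw⇒x≤w] ← ¬∀⟶∃¬ n _ (λ w → isBasis? (B [ x ↦ w ]) →-dec (toℕ x ≤? toℕ w))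
                                   (λ all → ¬IA (x∈B , all))
    = w , decidable-stable (isBasis? _) (λ ¬Cw → ¬[Cw⇒x≤w] (⊥-elim ∘ ¬Cw))

  IP⇒min-Cocirc< : ∀ {B x} → IP M B x →
    ∃[ y ] (InCocirc M B x y × toℕ y < toℕ x × ∀ w → InCocirc M B x w → toℕ y ≤ toℕ w)
  IP⇒min-Cocirc< {B} {x} IPx@(x∈B , ¬IA)
    with y , Cy , min ← ∃-least (InCocirc M B x) (λ w → isBasis? _) (IP⇒Cocirc-nonempty IPx)
    = y , Cy , ≰⇒> (λ x≤y → ¬IA (x∈B , λ w Cw → ≤-trans x≤y (min w Cw))) , min

  -- Cocirc(B[x↦y], y) agrees with Cocirc(B, x) away from x and y, and x > y.
  min-Cocirc-IA : ∀ {B x y} → y ∉ B → toℕ y < toℕ x →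
    (∀ w → InCocirc M B x w → toℕ y ≤ toℕ w) → IA M (B [ x ↦ y ]) y
  min-Cocirc-IA {B} {x} {y} y∉B y<x min = ∈[↦]⁺ʳ y≢x , y≤
    where
    y≢x : y ≢ x
    y≢x y≡x = <-irrefl (cong toℕ y≡x) y<x
    y≤ : ∀ w → InCocirc M (B [ x ↦ y ]) y w → toℕ y ≤ toℕ w
    y≤ w Cw with w ≟ y | w ≟ x
    ... | yes refl | _ = ≤-refl
    ... | no _ | yes refl = <⇒≤ y<x
    ... | no w≢y | no w≢x = min w (subst IsBasis ([↦][↦] y∉B w≢x w≢y) Cw)

  IP⇒exchange-≤ext/int : ∀ {B x} → IsBasis B → IP M B x →
    ∃[ y ] (y ∉ B × IsBasis (B [ x ↦ y ]) × _≤ext/int_ M (B [ x ↦ y ]) B)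
  IP⇒exchange-≤ext/int {B} {x} bB IPx@(x∈B , _) with IP⇒min-Cocirc< IPx
  ... | y , bB′ , y<x , min = y , y∉B , bB′ , IA-outside⇒≤ext/int new-active
    where
    y∉B : y ∉ B
    y∉B y∈B = x∉B[x↦y] x y (subst (x ∈_) (sym (basis-⊆⇒≡ bB′ bB B[x↦y]⊆B)) x∈B)
      where
      B[x↦y]⊆B : B [ x ↦ y ] ⊆ B
      B[x↦y]⊆B z∈ with ∈[↦]⁻ z∈
      ... | inj₁ z∈B , _ = z∈B
      ... | inj₂ refl , _ = y∈B
    new-active : ∀ z → z ∈ B [ x ↦ y ] → z ∉ B → IA M (B [ x ↦ y ]) z
    new-active z z∈ z∉B with ∈[↦]⁻ z∈
    ... | inj₁ z∈B , _ = contradiction z∈B z∉B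
    ... | inj₂ refl , _ = min-Cocirc-IA y∉B y<x min

  module _ (L : List (Subset n))
           (enumerates : ∀ B → (B ∈ᴸ L) ⇔ IsBasis B)
           (monotone : ∀ i j → _≤ext/int_ M (lookup L i) (lookup L j) → toℕ i ≤ toℕ j) where
    open Equivalence

    earlier-index : ∀ {B} (j : Fin (length L)) → IsBasis B →
      _≤ext/int_ M B (lookup L j) → B ≢ lookup L j → ∃[ l ] (toℕ l < toℕ j × lookup L l ≡ B)
    earlier-index {B} j bB B≤Bj B≢Bj = l , ≤∧≢⇒< l≤j l≢j , sym B≡Bl
      where
      B∈L : B ∈ᴸ L
      B∈L = from (enumerates B) bB
      l : Fin (length L)
      l = index B∈L
      B≡Bl : B ≡ lookup L l
      B≡Bl = lookup-index B∈L
      l≤j : toℕ l ≤ toℕ j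
      l≤j = monotone l j (subst (λ S → _≤ext/int_ M S (lookup L j)) B≡Bl B≤Bj)
      l≢j : toℕ l ≢ toℕ j
      l≢j l≡j = B≢Bj (trans B≡Bl (cong (lookup L) (toℕ-injective l≡j)))

    lookup-isBasis : ∀ j → IsBasis (lookup L j)
    lookup-isBasis j = to (enumerates (lookup L j)) (∈-lookup j)

    later-≰ext/int : ∀ {i j} → toℕ i < toℕ j → ¬ (_≤ext/int_ M (lookup L j) (lookup L i))
    later-≰ext/int {i} {j} i<j Bj≤Bi = <⇒≱ i<j (monotone j i Bj≤Bi)

    linearExtension-shells : ∀ (i j : Fin (length L)) → toℕ i < toℕ j →
      ∃[ l ] ∃[ f ] (toℕ l < toℕ j × f ∈ lookup L j ×
        ((lookup L i ∩ lookup L j) ⊆ (lookup L l ∩ lookup L j)) ×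
        ((lookup L l ∩ lookup L j) ≡ (lookup L j - f)))
    linearExtension-shells i j i<j
      with x , IPx@(x∈Bj , _) , x∉Bi ← ≰ext/int⇒IP-outside (later-≰ext/int i<j)
      with y , y∉Bj , bB , B≤Bj ← IP⇒exchange-≤ext/int (lookup-isBasis j) IPx
      with l , l<j , Bl≡B ← earlier-index j bB B≤Bj
                               (λ B≡Bj → x∉B[x↦y] x y (subst (x ∈_) (sym B≡Bj) x∈Bj))
      = l , x , l<j , x∈Bj
      , subst (λ S → lookup L i ∩ lookup L j ⊆ S ∩ lookup L j) (sym Bl≡B) (∩-⊆-[↦]∩ y x∉Bi)
      , subst (λ S → S ∩ lookup L j ≡ lookup L j - x) (sym Bl≡B) ([↦]∩≡- y∉Bj)

corollary4p4 : {n : ℕ} (M : Matroid n) (L : List (Subset n)) →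
    LinearExtension M L → ShellingOrder (INFacet M) L
corollary4p4 M L ((unique , enumerates) , monotone) =
  (unique , λ F → ⇔.trans (enumerates F) (isBasis⇔INFacet M F)) ,
  linearExtension-shells M L enumerates monotone
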